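{- Let $\Sigma$ be a finite alphabet, let $x\in\Sigma^*$ be a nonempty word and $\tilde{x}$ its circularization. Then $\mathcal{M}_{\tilde{x}}=\mathcal{M}_{xx}^{|x|}$, i.e. the set of minimal absent words of the circular word $\tilde{x}$ equals the set of minimal absent words of the linear word $xx$ that have length at most $|x|$.
   Context: For a factorial language $L\subseteq\Sigma^*$, $\mathcal{M}_L=\{aub\mid a,b\in\Sigma,\ u\in\Sigma^*,\ aub\notin L,\ au\in L,\ ub\in L\}$. For a word $x$ of length $m$, its rotations are $x^{\langle i\rangle}=x[i\,..\,m-1]x[0\,..\,i-1]$, $0\le i<m$; the circular word $\tilde{x}$ is the class of all rotations of $x$. $\mathcal{F}_{\tilde{x}^*}$ denotes the set of all factors of words in $x^*=\{x^k\mid k\ge0\}$ (independent of the chosen rotation), and the set of minimal absent words of $\tilde{x}$ is defined as $\mathcal{M}_{\tilde{x}}=\mathcal{M}_{\mathcal{F}_{\tilde{x}^*}}$. For a linear word $w$, $\mathcal{M}_w=\mathcal{M}_{\mathcal{F}_w}$ where $\mathcal{F}_w$ is the set of factors of $w$, and $\mathcal{M}_w^{\ell}$ denotes the set of elements of $\mathcal{M}_w$ of length at most $\ell$. -}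

module Defs where

open import Data.List using (List; []; _∷_; _++_; [_]; length)
open import Data.Nat using (ℕ; zero; suc)
open import Data.Product using (Σ; ∃; ∃-syntax; _×_; _,_)
open import Relation.Binary.PropositionalEquality using (_≡_)
open import Relation.Nullary using (¬_)
open import Level using (Level; _⊔_; suc)

_IsFactorOf_ : {A : Set} → List A → List A → Set
u IsFactorOf w = ∃[ p ] ∃[ s ] (p ++ u ++ s ≡ w)

Language : Set → Set₁
Language A = List A → Set

Factors : {A : Set} → List A → Language A
Factors w u = u IsFactorOf w

_^^_ : {A : Set} → List A → ℕ → List A
x ^^ zero = []
x ^^ Data.Nat.suc k = x ++ (x ^^ k)

CircFactors : {A : Set} → List A → Language A
CircFactors x u = ∃[ k ] (u IsFactorOf (x ^^ k))

MAW : {A : Set} → Language A → Language A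
MAW L w = ∃[ a ] ∃[ u ] ∃[ b ]
  ((w ≡ a ∷ u ++ [ b ]) × ¬ L w × L (a ∷ u) × L (u ++ [ b ]))

MAWcirc : {A : Set} → List A → Language A
MAWcirc x = MAW (CircFactors x)

MAWlin : {A : Set} → List A → Language A
MAWlin w = MAW (Factors w)

module Submission where

-- Let x be a nonempty word of length n and let cyc : ℕ → A be the
-- n-periodic sequence cyc i = x[i mod n].  Every power x^k is read by cyc
-- from position 0, so the circular factors of x are exactly the words that
-- occur somewhere in cyc, and such an occurrence can always be moved to a
-- position below n.  Consequently:
--   * a circular factor of length ≤ n lies inside xx, and every factor of
--     xx is a circular factor;
--   * (extension) if au and ub are circular factors with |au| ≥ n, then aub
--     is one too: for |u| ≥ n the letter after u is forced by periodicity;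
--     for |au| = n both au and ub are rotations of x, hence permutations of
--     x, so a = b and aub = (au)a is again read by cyc.
-- By extension no minimal absent word of the circular word is longer than n,
-- and the theorem follows by comparing the two definitions letter by letter.

open import Defs
open import Data.Fin using (Fin)
open import Data.List using (List; []; _∷_; _++_; length; [_]; take; drop)
open import Data.List.Properties
  using (length-++; length-++-comm; length-take; length-drop; take++drop≡id; ++-identityʳ)
open import Data.List.Relation.Binary.Permutation.Propositional
  using (_↭_; ↭-sym; ↭-trans; ↭-reflexive)
open import Data.List.Relation.Binary.Permutation.Propositional.Properties
  using (drop-∷; ↭-singleton-inv; ++-comm)
open import Data.Nat
  using (ℕ; _≤_; _<_; zero; suc; _+_; _*_; _∸_; s≤s; s≤s⁻¹; z<s; NonZero; >-nonZero⁻¹; _≤?_)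
open import Data.Nat.Properties
open import Data.Nat.DivMod
  using (_%_; m%n%n≡m%n; [m+n]%n≡m%n; n%n≡0; m%n<n; m<n⇒m%n≡m; %-distribˡ-+)
open import Data.Product using (_×_; _,_; proj₁; ∃-syntax)
open import Data.Sum using (inj₁; inj₂)
open import Data.Unit using (⊤; tt)
open import Data.Empty using (⊥-elim)
open import Function using (_∘_)
open import Function.Bundles using (_⇔_; mk⇔)
open import Relation.Binary.PropositionalEquality
  using (_≡_; _≢_; refl; sym; trans; cong; cong₂; subst; module ≡-Reasoning)
open import Relation.Nullary using (yes; no)

module _ {A : Set} where

  ↭-cancel-prefix : ∀ (w : List A) {v v′} → w ++ v ↭ w ++ v′ → v ↭ v′
  ↭-cancel-prefix []      p = p
  ↭-cancel-prefix (c ∷ w) p = ↭-cancel-prefix w (drop-∷ p)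

  ↭-cancel-head : ∀ (u : List A) {a b} → a ∷ u ↭ b ∷ u → a ≡ b
  ↭-cancel-head u {a} {b} p
    with ↭-singleton-inv (↭-cancel-prefix u (↭-trans (++-comm u [ a ]) (↭-trans p (++-comm [ b ] u))))
  ... | refl = refl

  length-aub : ∀ (a : A) u b → length (a ∷ u ++ [ b ]) ≡ suc (suc (length u))
  length-aub a u b = cong suc (length-++-comm u [ b ])

  length-take-≤ : ∀ {m} (l : List A) → m ≤ length l → length (take m l) ≡ m
  length-take-≤ {m} l m≤ = trans (length-take m l) (m≤n⇒m⊓n≡m m≤)

  Occurs : (ℕ → A) → List A → ℕ → Set
  Occurs f []      p = ⊤
  Occurs f (c ∷ u) p = c ≡ f p × Occurs f u (suc p)

  occurs-++ : ∀ {f} u {v p} → Occurs f u p → Occurs f v (p + length u) → Occurs f (u ++ v) p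
  occurs-++ []      {p = p} _       o′ = subst (Occurs _ _) (+-identityʳ p) o′
  occurs-++ (c ∷ u) {p = p} (e , o) o′ = e , occurs-++ u o (subst (Occurs _ _) (+-suc p (length u)) o′)

  occurs-prefix : ∀ {f} u {v p} → Occurs f (u ++ v) p → Occurs f u p
  occurs-prefix []      _       = tt
  occurs-prefix (c ∷ u) (e , o) = e , occurs-prefix u o

  occurs-suffix : ∀ {f} u {v p} → Occurs f (u ++ v) p → Occurs f v (p + length u)
  occurs-suffix []      {p = p} o       = subst (Occurs _ _) (sym (+-identityʳ p)) o
  occurs-suffix (c ∷ u) {p = p} (_ , o) = subst (Occurs _ _) (sym (+-suc p (length u))) (occurs-suffix u o)

  occurs-take : ∀ {f} r u {p} → Occurs f u p → Occurs f (take r u) p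
  occurs-take zero    u       _       = tt
  occurs-take (suc r) []      _       = tt
  occurs-take (suc r) (c ∷ u) (e , o) = e , occurs-take r u o

  occurs-drop : ∀ {f} r u {p} → Occurs f u p → Occurs f (drop r u) (p + r)
  occurs-drop zero    u       {p} o       = subst (Occurs _ _) (sym (+-identityʳ p)) o
  occurs-drop (suc r) []          _       = tt
  occurs-drop (suc r) (c ∷ u) {p} (_ , o) = subst (Occurs _ _) (sym (+-suc p r)) (occurs-drop r u o)

  occurs-ext : ∀ {f g} u {p q} → (∀ i → i < length u → f (p + i) ≡ g (q + i)) →
               Occurs f u p → Occurs g u q
  occurs-ext []      _ _ = tt
  occurs-ext {f} {g} (c ∷ u) {p} {q} agree (e , o) =
    trans e (trans (cong f (sym (+-identityʳ p))) (trans (agree 0 z<s) (cong g (+-identityʳ q)))) ,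
    occurs-ext u (λ i i< → trans (cong f (sym (+-suc p i))) (trans (agree (suc i) (s≤s i<)) (cong g (+-suc q i)))) o

  occurs-agree : ∀ {f g} u {p q} → Occurs f u p → Occurs g u q →
                 ∀ i → i < length u → f (p + i) ≡ g (q + i)
  occurs-agree {f} {g} (c ∷ u) {p} {q} (e , _) (e′ , _) zero _ =
    trans (cong f (+-identityʳ p)) (trans (sym e) (trans e′ (cong g (sym (+-identityʳ q)))))
  occurs-agree {f} {g} (c ∷ u) {p} {q} (_ , o) (_ , o′) (suc i) (s≤s i<) =
    trans (cong f (+-suc p i)) (trans (occurs-agree u o o′ i i<) (cong g (sym (+-suc q i))))

  occurs-unique : ∀ {f} u v {p} → length u ≡ length v → Occurs f u p → Occurs f v p → u ≡ v
  occurs-unique []      []      _  _       _        = refl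
  occurs-unique (c ∷ u) (d ∷ v) eq (e , o) (e′ , o′) =
    cong₂ _∷_ (trans e (sym e′)) (occurs-unique u v (suc-injective eq) o o′)

  index : List A → A → ℕ → A
  index []      d i       = d
  index (c ∷ u) d zero    = c
  index (c ∷ u) d (suc i) = index u d i

  occurs-index : ∀ w d → Occurs (index w d) w 0
  occurs-index []      d = tt
  occurs-index (c ∷ w) d = refl , occurs-ext w (λ _ _ → refl) (occurs-index w d)

  occurs⇒factor : ∀ {f} w u {q} → q + length u ≤ length w →
                  Occurs f w 0 → Occurs f u q → u IsFactorOf w
  occurs⇒factor w u {q} fits ow ou = take q w , drop m rest , (begin
      take q w ++ u ++ drop m rest           ≡⟨ cong (λ v → take q w ++ v ++ drop m rest) u≡ ⟩
      take q w ++ take m rest ++ drop m rest ≡⟨ cong (take q w ++_) (take++drop≡id m rest) ⟩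
      take q w ++ rest                       ≡⟨ take++drop≡id q w ⟩
      w                                      ∎)
    where
      open ≡-Reasoning
      m = length u
      rest = drop q w
      m≤rest : m ≤ length rest
      m≤rest = subst (m ≤_) (sym (length-drop q w))
                 (subst (_≤ length w ∸ q) (m+n∸m≡n q m) (∸-monoˡ-≤ q fits))
      u≡ : u ≡ take m rest
      u≡ = occurs-unique u (take m rest) (sym (length-take-≤ rest m≤rest))
             ou (occurs-take m rest (occurs-drop q w ow))

  factor⇒occurs : ∀ {f w u} → Occurs f w 0 → u IsFactorOf w → ∃[ q ] Occurs f u q
  factor⇒occurs {u = u} ow (pre , _ , refl) = length pre , occurs-prefix u (occurs-suffix pre ow)

  periodic-next : ∀ {f} n .{{_ : NonZero n}} → (∀ i → f (i + n) ≡ f i) →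
                  ∀ u {p q} → n ≤ length u → Occurs f u p → Occurs f u q →
                  f (p + length u) ≡ f (q + length u)
  periodic-next {f} n periodic u {p} {q} n≤u op oq = begin
      f (p + length u) ≡⟨ cong f (split p) ⟩
      f (p + j + n)    ≡⟨ periodic (p + j) ⟩
      f (p + j)        ≡⟨ occurs-agree u op oq j j<u ⟩
      f (q + j)        ≡⟨ sym (periodic (q + j)) ⟩
      f (q + j + n)    ≡⟨ cong f (sym (split q)) ⟩
      f (q + length u) ∎
    where
      open ≡-Reasoning
      j = length u ∸ n
      j<u : j < length u
      j<u = ∸-monoʳ-< (>-nonZero⁻¹ n) n≤u
      split : ∀ r → r + length u ≡ r + j + n
      split r = trans (cong (r +_) (sym (m∸n+n≡m n≤u))) (sym (+-assoc r j n))

module Cyclic {A : Set} (c : A) (xs : List A) where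

  x : List A
  x = c ∷ xs

  -- n is length x (definitionally), written so that NonZero n is evident.
  n : ℕ
  n = suc (length xs)

  cyc : ℕ → A
  cyc i = index x c (i % n)

  cyc-mod : ∀ i j → i % n ≡ j % n → cyc i ≡ cyc j
  cyc-mod _ _ = cong (index x c)

  cyc-periodic : ∀ i → cyc (i + n) ≡ cyc i
  cyc-periodic i = cyc-mod (i + n) i ([m+n]%n≡m%n i n)

  +-mod : ∀ p q i → p % n ≡ q % n → (p + i) % n ≡ (q + i) % n
  +-mod p q i p≡q = begin
      (p + i) % n         ≡⟨ %-distribˡ-+ p i n ⟩
      (p % n + i % n) % n ≡⟨ cong (λ r → (r + i % n) % n) p≡q ⟩
      (q % n + i % n) % n ≡⟨ sym (%-distribˡ-+ q i n) ⟩
      (q + i) % n         ∎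
    where open ≡-Reasoning

  occurs-mod : ∀ u {p q} → p % n ≡ q % n → Occurs cyc u p → Occurs cyc u q
  occurs-mod u {p} {q} p≡q = occurs-ext u (λ i _ → cyc-mod (p + i) (q + i) (+-mod p q i p≡q))

  occurs-reduce : ∀ u {p} → Occurs cyc u p → Occurs cyc u (p % n)
  occurs-reduce u {p} = occurs-mod u (sym (m%n%n≡m%n p n))

  occurs-+n : ∀ u {p} → Occurs cyc u p → Occurs cyc u (p + n)
  occurs-+n u {p} = occurs-mod u (sym ([m+n]%n≡m%n p n))

  x-occurs : Occurs cyc x 0
  x-occurs = occurs-ext x (λ i i<n → cong (index x c) (sym (m<n⇒m%n≡m i<n))) (occurs-index x c)

  xx-occurs : Occurs cyc (x ++ x) 0
  xx-occurs = occurs-++ x x-occurs (occurs-+n x x-occurs)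

  power-occurs : ∀ k → Occurs cyc (x ^^ k) 0
  power-occurs zero    = tt
  power-occurs (suc k) = occurs-++ x x-occurs (occurs-+n (x ^^ k) (power-occurs k))

  length-power : ∀ k → length (x ^^ k) ≡ k * n
  length-power zero    = refl
  length-power (suc k) = trans (length-++ x) (cong (n +_) (length-power k))

  circ⇒occurs : ∀ {u} → CircFactors x u → ∃[ q ] Occurs cyc u q
  circ⇒occurs (k , u∈xᵏ) = factor⇒occurs (power-occurs k) u∈xᵏ

  occurs⇒circ : ∀ u {q} → Occurs cyc u q → CircFactors x u
  occurs⇒circ u {q} o =
    suc (length u) , occurs⇒factor (x ^^ suc (length u)) u fits (power-occurs (suc (length u))) (occurs-reduce u o)
    where
      open ≤-Reasoning
      fits : q % n + length u ≤ length (x ^^ suc (length u))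
      fits = begin
        q % n + length u     ≤⟨ +-monoˡ-≤ (length u) (<⇒≤ (m%n<n q n)) ⟩
        n + length u         ≤⟨ +-monoʳ-≤ n (m≤m*n (length u) n) ⟩
        n + length u * n     ≡⟨ sym (length-power (suc (length u))) ⟩
        length (x ^^ suc (length u)) ∎

  factor-xx⇒circ : ∀ {u} → u IsFactorOf (x ++ x) → CircFactors x u
  factor-xx⇒circ (pre , suf , eq) = 2 , pre , suf , trans eq (cong (x ++_) (sym (++-identityʳ x)))

  circ⇒factor-xx : ∀ {u} → length u ≤ n → CircFactors x u → u IsFactorOf (x ++ x)
  circ⇒factor-xx {u} u≤n cu with circ⇒occurs cu
  ... | q , o = occurs⇒factor (x ++ x) u fits xx-occurs (occurs-reduce u o)
    where
      fits : q % n + length u ≤ length (x ++ x)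
      fits = ≤-trans (+-mono-≤ (<⇒≤ (m%n<n q n)) u≤n) (≤-reflexive (sym (length-++ x)))

  -- Every window of length n in cyc is a rotation, hence a permutation, of x.
  window-↭ : ∀ v {s} → length v ≡ n → Occurs cyc v s → v ↭ x
  window-↭ v {s} v≡n o =
    ↭-trans (↭-reflexive v≡rot) (↭-trans (++-comm (drop r x) (take r x)) (↭-reflexive (take++drop≡id r x)))
    where
      r = s % n
      r+rest≡n : r + length (drop r x) ≡ n
      r+rest≡n = trans (cong (r +_) (length-drop r x)) (m+[n∸m]≡n (<⇒≤ (m%n<n s n)))
      rot-occurs : Occurs cyc (drop r x ++ take r x) r
      rot-occurs = occurs-++ (drop r x) (occurs-drop r x x-occurs)
        (occurs-mod (take r x) (sym (trans (cong (_% n) r+rest≡n) (n%n≡0 n))) (occurs-take r x x-occurs))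
      length-rot : length (drop r x ++ take r x) ≡ n
      length-rot = trans (length-++-comm (drop r x) (take r x)) (cong length (take++drop≡id r x))
      v≡rot : v ≡ drop r x ++ take r x
      v≡rot = occurs-unique v _ (trans v≡n (sym length-rot)) (occurs-reduce v o) rot-occurs

  -- Extension, case |u| ≥ n: the letter after u is forced by periodicity.
  next-periodic : ∀ u b {p q} → n ≤ length u → Occurs cyc u (suc p) → Occurs cyc (u ++ [ b ]) q →
                  b ≡ cyc (suc p + length u)
  next-periodic u b n≤u ou oub =
    trans (proj₁ (occurs-suffix u oub)) (periodic-next n cyc-periodic u n≤u (occurs-prefix u oub) ou)

  -- Extension, case |au| = n: au and ub are permutations of x, so b = a.
  next-rotation : ∀ a u b {p q} → n ≡ length (a ∷ u) → Occurs cyc (a ∷ u) p → Occurs cyc (u ++ [ b ]) q →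
                  b ≡ cyc (suc p + length u)
  next-rotation a u b {p} n≡au oau@(a≡ , _) oub = begin
      b                       ≡⟨ sym a≡b ⟩
      a                       ≡⟨ a≡ ⟩
      cyc p                   ≡⟨ sym (cyc-periodic p) ⟩
      cyc (p + n)             ≡⟨ cong (λ m → cyc (p + m)) n≡au ⟩
      cyc (p + suc (length u)) ≡⟨ cong cyc (+-suc p (length u)) ⟩
      cyc (suc p + length u)  ∎
    where
      open ≡-Reasoning
      au↭x : a ∷ u ↭ x
      au↭x = window-↭ (a ∷ u) (sym n≡au) oau
      ub↭x : u ++ [ b ] ↭ x
      ub↭x = window-↭ (u ++ [ b ]) (trans (length-++-comm u [ b ]) (sym n≡au)) oub
      a≡b : a ≡ b
      a≡b = ↭-cancel-head u (↭-trans au↭x (↭-trans (↭-sym ub↭x) (++-comm u [ b ])))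

  extend : ∀ a u b → n ≤ length (a ∷ u) → CircFactors x (a ∷ u) → CircFactors x (u ++ [ b ]) →
           CircFactors x (a ∷ u ++ [ b ])
  extend a u b n≤au cau cub with circ⇒occurs cau | circ⇒occurs cub
  ... | p , oau@(a≡ , ou) | q , oub =
    occurs⇒circ (a ∷ u ++ [ b ]) {p} (a≡ , occurs-++ u ou (next-letter , tt))
    where
      next-letter : b ≡ cyc (suc p + length u)
      next-letter with m≤n⇒m<n∨m≡n n≤au
      ... | inj₁ n<au = next-periodic u b (s≤s⁻¹ n<au) ou oub
      ... | inj₂ n≡au = next-rotation a u b n≡au oau oub

  MAWcirc-short : ∀ {w} → MAWcirc x w → length w ≤ n
  MAWcirc-short (a , u , b , refl , absent , cau , cub) with n ≤? length (a ∷ u)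
  ... | yes n≤au = ⊥-elim (absent (extend a u b n≤au cau cub))
  ... | no  n≰au = subst (_≤ n) (sym (length-aub a u b)) (≰⇒> n≰au)

  MAWcirc⇒MAWxx : ∀ {w} → MAWcirc x w → MAWlin (x ++ x) w
  MAWcirc⇒MAWxx m@(a , u , b , refl , absent , cau , cub) =
    a , u , b , refl , absent ∘ factor-xx⇒circ , circ⇒factor-xx au≤n cau , circ⇒factor-xx ub≤n cub
    where
      au≤n : length (a ∷ u) ≤ n
      au≤n = ≤-trans (n≤1+n _) (subst (_≤ n) (length-aub a u b) (MAWcirc-short m))
      ub≤n : length (u ++ [ b ]) ≤ n
      ub≤n = subst (_≤ n) (sym (length-++-comm u [ b ])) au≤n

  MAWxx⇒MAWcirc : ∀ {w} → length w ≤ n → MAWlin (x ++ x) w → MAWcirc x w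
  MAWxx⇒MAWcirc w≤n (a , u , b , eq , absent , fau , fub) =
    a , u , b , eq , absent ∘ circ⇒factor-xx w≤n , factor-xx⇒circ fau , factor-xx⇒circ fub

corollary1 : (σ : ℕ) (x : List (Fin σ)) → x ≢ [] →
    (w : List (Fin σ)) → MAWcirc x w ⇔ (MAWlin (x ++ x) w × length w ≤ length x)
corollary1 σ []       x≢[] w = ⊥-elim (x≢[] refl)
corollary1 σ (c ∷ xs) _    w =
  mk⇔ (λ m → MAWcirc⇒MAWxx m , MAWcirc-short m) (λ (m , w≤n) → MAWxx⇒MAWcirc w≤n m)
  where open Cyclic c xs
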